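{- Let $\mathcal{A} = \{a_1 \prec a_2 \prec a_3\}$ be a totally ordered ternary alphabet, and let $w$ be a nonempty word over $\mathcal{A}$ whose Lyndon factorization is $w = l_1 l_2 \cdots l_h$, where the $l_i$ are Lyndon words with $l_1 \succ l_2 \succ \cdots \succ l_h$ (so that the $h$ factors are distinct). Then $h \geq \mathrm{comp}(G(w))$, where $\mathrm{comp}(G)$ denotes the number of connected components of a graph $G$ and $G(w)$ is the Lyndon graph of $w$.
   Context: Words over $\mathcal{A}$ are compared in the lexicographic order induced by $\prec$. A nonempty word $w$ is primitive if $w = u^m$ with $u$ a nonempty word implies $m = 1$. Two words are conjugate if they are of the form $w_1 w_2$ and $w_2 w_1$. A Lyndon word is a primitive word that is lexicographically smallest in its conjugacy class. Every nonempty word $w$ can be written uniquely as $w = l_1 \cdots l_h$ with $l_i$ Lyndon words and $l_1 \succeq l_2 \succeq \cdots \succeq l_h$ (the Lyndon factorization). For a word $w = w_1 \cdots w_N$ over $\mathcal{A}$, its Lyndon graph $G(w)$ is the simple undirected graph with vertex set $\{1, \dots, N\}$ in which, for $1 \le i < j \le N$, the vertices $i$ and $j$ are adjacent if and only if the scattered subword $w_i w_j$ has the form $a_r a_s$ with $r < s$, i.e. $w_i \prec w_j$. -}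

module Defs where

open import Data.Nat using (ℕ; suc)
open import Data.Fin using (Fin; toℕ)
import Data.Fin as F
open import Data.List using (List; []; _∷_; _++_; concat; replicate; length; lookup)
open import Data.Product using (_×_; Σ; ∃)
open import Data.Sum using (_⊎_)
open import Relation.Binary.PropositionalEquality using (_≡_; _≢_)
open import Relation.Binary.Construct.Closure.ReflexiveTransitive using (Star)

-- The ternary alphabet A = {a₁ ≺ a₂ ≺ a₃}, encoded as Fin 3 with 0 ≺ 1 ≺ 2.
Letter : Set
Letter = Fin 3

Word : Set
Word = List Letter

infix 4 _≺_ _⪯_
data _≺_ : Word → Word → Set where
  []≺∷  : ∀ {b ys} → [] ≺ (b ∷ ys)
  here  : ∀ {a b xs ys} → a F.< b → (a ∷ xs) ≺ (b ∷ ys)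
  there : ∀ {a xs ys} → xs ≺ ys → (a ∷ xs) ≺ (a ∷ ys)

_⪯_ : Word → Word → Set
u ⪯ v = u ≺ v ⊎ u ≡ v

_^ʷ_ : Word → ℕ → Word
u ^ʷ m = concat (replicate m u)

Primitive : Word → Set
Primitive w = (w ≢ []) × (∀ (u : Word) (m : ℕ) → u ≢ [] → w ≡ u ^ʷ m → m ≡ 1)

-- Lyndon: primitive and lexicographically smallest in its conjugacy class.
-- The conjugates of w are exactly the words v ++ u with w ≡ u ++ v.
Lyndon : Word → Set
Lyndon w = Primitive w × (∀ (u v : Word) → w ≡ u ++ v → w ⪯ v ++ u)

data StrictlyDecreasingLyndon : List Word → Set where
  []  : StrictlyDecreasingLyndon []
  [_] : ∀ {l} → Lyndon l → StrictlyDecreasingLyndon (l ∷ [])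
  _∷_ : ∀ {l l' ls} → Lyndon l → l' ≺ l →
        StrictlyDecreasingLyndon (l' ∷ ls) → StrictlyDecreasingLyndon (l ∷ l' ∷ ls)

Graph : ℕ → Set₁
Graph n = Fin n → Fin n → Set

-- Lyndon graph G(w): vertices 1..N (here Fin N, 0-based), and for i < j,
-- i ~ j iff w_i ≺ w_j.  Adjacency is symmetrised.
LyndonGraph : (w : Word) → Graph (length w)
LyndonGraph w i j =
  (i F.< j × lookup w i F.< lookup w j) ⊎ (j F.< i × lookup w j F.< lookup w i)

Connected : ∀ {n} → Graph n → Fin n → Fin n → Set
Connected G = Star G

-- G has exactly k connected components: there is a surjective labelling
-- c : Fin n → Fin k with c i ≡ c j exactly when i and j are connected
-- (i.e. Fin k is in bijection with the set of connected components).
HasComponents : ∀ {n} → Graph n → ℕ → Set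
HasComponents {n} G k =
  Σ (Fin n → Fin k) λ c →
    (∀ (x : Fin k) → ∃ λ i → c i ≡ x) ×
    (∀ i j → (c i ≡ c j → Connected G i j) × (Connected G i j → c i ≡ c j))

{-# OPTIONS --safe #-}
-- Each Lyndon factor c t spans a connected subgraph: c is its least letter, so every
-- position carrying a larger letter is adjacent to the first one, and every other
-- occurrence of c is adjacent to the last position, whose letter exceeds c because a
-- Lyndon word of length at least 2 never ends with its first letter. Hence labelling
-- each position by its factor and picking one position per component gives an
-- injection from components into factors.
module Submission where

open import Defs
open import Data.Nat using (ℕ; _≤_; _+_; suc; z<s; s<s)
import Data.Nat.Properties as ℕₚ
open import Data.Fin using (Fin; zero; suc)
import Data.Fin as F
import Data.Fin.Properties as FP
open import Data.List using (List; []; _∷_; _++_; _∷ʳ_; concat; length; lookup; initLast; _∷ʳ′_)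
open import Data.List.Membership.Propositional using (_∈_)
open import Data.List.Membership.Propositional.Properties using (∈-∃++; ∈-++⁺ˡ; ∈-++⁺ʳ; ∈-lookup)
open import Data.List.Relation.Unary.Any using (here; there)
open import Data.List.Relation.Unary.All using (All; []; _∷_)
import Data.List.Relation.Unary.All as All
open import Data.Product using (_,_; proj₁; proj₂)
open import Data.Sum using (inj₁; inj₂)
open import Relation.Nullary using (contradiction)
open import Relation.Binary using (tri<; tri≈; tri>)
open import Relation.Binary.PropositionalEquality
open import Relation.Binary.Construct.Closure.ReflexiveTransitive using (ε; _◅_; _◅◅_; gmap; reverse)

private
  variable
    A : Set

inject++ : (u v : List A) → Fin (length u) → Fin (length (u ++ v))
inject++ (x ∷ u) v zero    = zero
inject++ (x ∷ u) v (suc i) = suc (inject++ u v i)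

raise++ : (u v : List A) → Fin (length v) → Fin (length (u ++ v))
raise++ []      v j = j
raise++ (x ∷ u) v j = suc (raise++ u v j)

data Split++ (u v : List A) : Fin (length (u ++ v)) → Set where
  left  : (i : Fin (length u)) → Split++ u v (inject++ u v i)
  right : (j : Fin (length v)) → Split++ u v (raise++ u v j)

split++ : (u v : List A) (p : Fin (length (u ++ v))) → Split++ u v p
split++ []      v p       = right p
split++ (x ∷ u) v zero    = left zero
split++ (x ∷ u) v (suc p) with split++ u v p
... | left i  = left (suc i)
... | right j = right j

lookup-inject++ : (u v : List A) (i : Fin (length u)) → lookup (u ++ v) (inject++ u v i) ≡ lookup u i
lookup-inject++ (x ∷ u) v zero    = refl
lookup-inject++ (x ∷ u) v (suc i) = lookup-inject++ u v i

lookup-raise++ : (u v : List A) (j : Fin (length v)) → lookup (u ++ v) (raise++ u v j) ≡ lookup v j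
lookup-raise++ []      v j = refl
lookup-raise++ (x ∷ u) v j = lookup-raise++ u v j

inject++-mono-< : (u v : List A) {i j : Fin (length u)} → i F.< j → inject++ u v i F.< inject++ u v j
inject++-mono-< (x ∷ u) v {zero}  {suc j} _         = z<s
inject++-mono-< (x ∷ u) v {suc i} {suc j} (s<s i<j) = s<s (inject++-mono-< u v i<j)

raise++-mono-< : (u v : List A) {i j : Fin (length v)} → i F.< j → raise++ u v i F.< raise++ u v j
raise++-mono-< []      v i<j = i<j
raise++-mono-< (x ∷ u) v i<j = s<s (raise++-mono-< u v i<j)

inject++<raise++ : (u v : List A) (i : Fin (length u)) (j : Fin (length v)) → inject++ u v i F.< raise++ u v j
inject++<raise++ (x ∷ u) v zero    j = z<s
inject++<raise++ (x ∷ u) v (suc i) j = s<s (inject++<raise++ u v i j)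

LyndonGraph-sym : (w : Word) {i j : Fin (length w)} → LyndonGraph w i j → LyndonGraph w j i
LyndonGraph-sym w (inj₁ i~j) = inj₂ i~j
LyndonGraph-sym w (inj₂ j~i) = inj₁ j~i

LyndonGraph-edge : (w : Word) {i j : Fin (length w)} →
                   i F.< j → lookup w i F.< lookup w j → LyndonGraph w i j
LyndonGraph-edge w i<j wi<wj = inj₁ (i<j , wi<wj)

Connected-embedding : (u w : Word) (f : Fin (length u) → Fin (length w)) →
                      (∀ {i j} → i F.< j → f i F.< f j) →
                      (∀ i → lookup w (f i) ≡ lookup u i) →
                      ∀ {i j} → Connected (LyndonGraph u) i j → Connected (LyndonGraph w) (f i) (f j)
Connected-embedding u w f f-mono lookup-f = gmap f edge
  where
  letters : ∀ {i j} → lookup u i F.< lookup u j → lookup w (f i) F.< lookup w (f j)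
  letters = subst₂ F._<_ (sym (lookup-f _)) (sym (lookup-f _))
  edge : ∀ {i j} → LyndonGraph u i j → LyndonGraph w (f i) (f j)
  edge (inj₁ (i<j , ui<uj)) = inj₁ (f-mono i<j , letters ui<uj)
  edge (inj₂ (j<i , uj<ui)) = inj₂ (f-mono j<i , letters uj<ui)

Connected-inject++ : (u v : Word) {i j : Fin (length u)} → Connected (LyndonGraph u) i j →
                     Connected (LyndonGraph (u ++ v)) (inject++ u v i) (inject++ u v j)
Connected-inject++ u v = Connected-embedding u (u ++ v) (inject++ u v) (inject++-mono-< u v) (lookup-inject++ u v)

Connected-raise++ : (u v : Word) {i j : Fin (length v)} → Connected (LyndonGraph v) i j →
                    Connected (LyndonGraph (u ++ v)) (raise++ u v i) (raise++ u v j)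
Connected-raise++ u v = Connected-embedding v (u ++ v) (raise++ u v) (raise++-mono-< u v) (lookup-raise++ u v)

⪯-head : ∀ {a b xs ys} → a ∷ xs ⪯ b ∷ ys → a F.≤ b
⪯-head (inj₁ (here a<b)) = ℕₚ.<⇒≤ a<b
⪯-head (inj₁ (there _))  = ℕₚ.≤-refl
⪯-head (inj₂ refl)       = ℕₚ.≤-refl

⪯-tail : ∀ {a xs ys} → a ∷ xs ⪯ a ∷ ys → xs ⪯ ys
⪯-tail (inj₁ (here a<a))    = contradiction a<a (FP.<-irrefl refl)
⪯-tail (inj₁ (there xs≺ys)) = inj₁ xs≺ys
⪯-tail (inj₂ refl)          = inj₂ refl

Lyndon⇒head-minimal : ∀ {c t x} → Lyndon (c ∷ t) → x ∈ c ∷ t → c F.≤ x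
Lyndon⇒head-minimal (_ , minimal) x∈w with ∈-∃++ x∈w
... | ys , zs , w≡ys++x∷zs = ⪯-head (minimal ys (_ ∷ zs) w≡ys++x∷zs)

∷ʳ⪯∷⇒power : ∀ c s → All (c F.≤_) s → s ∷ʳ c ⪯ c ∷ s → s ∷ʳ c ≡ (c ∷ []) ^ʷ suc (length s)
∷ʳ⪯∷⇒power c []      []          _     = refl
∷ʳ⪯∷⇒power c (x ∷ s) (c≤x ∷ c≤s) sc⪯cs with FP.≤-antisym (⪯-head sc⪯cs) c≤x
... | refl = cong (c ∷_) (∷ʳ⪯∷⇒power c s c≤s (⪯-tail sc⪯cs))

Lyndon⇒head<last : ∀ {c s d} → Lyndon (c ∷ s ∷ʳ d) → c F.< d
Lyndon⇒head<last {c} {s} {d} L with FP.<-cmp c d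
... | tri< c<d _ _ = c<d
... | tri> _ _ d<c = contradiction (Lyndon⇒head-minimal L (there (∈-++⁺ʳ s (here refl)))) (ℕₚ.<⇒≱ d<c)
... | tri≈ _ refl _ = contradiction (proj₂ (proj₁ L) (c ∷ []) (2 + length s) (λ ()) c^n) λ ()
  where
  c≤s : All (c F.≤_) s
  c≤s = All.tabulate (λ x∈s → Lyndon⇒head-minimal L (there (∈-++⁺ˡ x∈s)))
  c^n : c ∷ s ∷ʳ c ≡ (c ∷ []) ^ʷ (2 + length s)
  c^n = cong (c ∷_) (∷ʳ⪯∷⇒power c s c≤s (⪯-tail (proj₂ L (c ∷ s) (c ∷ []) refl)))

Lyndon∷ʳ⇒connected : ∀ {c s d} → Lyndon (c ∷ s ∷ʳ d) →
                     ∀ p → Connected (LyndonGraph (c ∷ s ∷ʳ d)) p zero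
Lyndon∷ʳ⇒connected {c} {s} {d} L p = to-head p (split++ (c ∷ s) (d ∷ []) p)
  where
  w : Word
  w = c ∷ s ∷ʳ d
  last : Fin (length w)
  last = raise++ (c ∷ s) (d ∷ []) zero
  c<last : c F.< lookup w last
  c<last = subst (c F.<_) (sym (lookup-raise++ (c ∷ s) (d ∷ []) zero)) (Lyndon⇒head<last L)
  last~head : LyndonGraph w last zero
  last~head = LyndonGraph-sym w (LyndonGraph-edge w z<s c<last)
  to-head : ∀ p → Split++ (c ∷ s) (d ∷ []) p → Connected (LyndonGraph w) p zero
  to-head _ (right zero) = last~head ◅ ε
  to-head _ (left zero)  = ε
  to-head p (left (suc i)) with FP.<-cmp c (lookup w p)
  ... | tri< c<e _ _ = LyndonGraph-sym w (LyndonGraph-edge w z<s c<e) ◅ ε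
  ... | tri> _ _ e<c = contradiction (Lyndon⇒head-minimal L (∈-lookup p)) (ℕₚ.<⇒≱ e<c)
  -- a letter equal to the head lies before the last letter, which exceeds the head
  ... | tri≈ _ c≡e _ = LyndonGraph-edge w (inject++<raise++ (c ∷ s) (d ∷ []) (suc i) zero)
                         (subst (F._< lookup w last) c≡e c<last)
                       ◅ last~head ◅ ε

Lyndon⇒connected-to-head : ∀ {c t} → Lyndon (c ∷ t) → ∀ p → Connected (LyndonGraph (c ∷ t)) p zero
Lyndon⇒connected-to-head {t = t} L p with initLast t
Lyndon⇒connected-to-head L zero | []      = ε
Lyndon⇒connected-to-head L p    | s ∷ʳ′ d = Lyndon∷ʳ⇒connected L p

Lyndon⇒connected : ∀ {l} → Lyndon l → ∀ i j → Connected (LyndonGraph l) i j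
Lyndon⇒connected {c ∷ t} L i j =
  Lyndon⇒connected-to-head L i ◅◅ reverse (LyndonGraph-sym (c ∷ t)) (Lyndon⇒connected-to-head L j)

factor : (ls : List Word) → Fin (length (concat ls)) → Fin (length ls)
factor (l ∷ ls) p with split++ l (concat ls) p
... | left _  = zero
... | right q = suc (factor ls q)

same-factor⇒connected : ∀ {ls} → All Lyndon ls → ∀ p q → factor ls p ≡ factor ls q →
                         Connected (LyndonGraph (concat ls)) p q
same-factor⇒connected {l ∷ ls} (L ∷ Ls) p q same
  with split++ l (concat ls) p | split++ l (concat ls) q
... | left i  | left j  = Connected-inject++ l (concat ls) (Lyndon⇒connected L i j)
... | right i | right j = Connected-raise++ l (concat ls)
                            (same-factor⇒connected Ls i j (FP.suc-injective same))
... | left _  | right _ = contradiction same λ ()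
... | right _ | left _  = contradiction same λ ()

HasComponents⇒≤ : ∀ {n m k} {G : Graph n} → HasComponents G k →
                  (b : Fin n → Fin m) → (∀ i j → b i ≡ b j → Connected G i j) → k ≤ m
HasComponents⇒≤ {n} {k = k} (component , onto , exact) b b-connected = FP.injective⇒≤ injective
  where
  representative : Fin k → Fin n
  representative x = proj₁ (onto x)
  injective : ∀ {x y} → b (representative x) ≡ b (representative y) → x ≡ y
  injective {x} {y} same = begin
    x                              ≡⟨ sym (proj₂ (onto x)) ⟩
    component (representative x)   ≡⟨ proj₂ (exact _ _) (b-connected _ _ same) ⟩
    component (representative y)   ≡⟨ proj₂ (onto y) ⟩
    y                              ∎
    where open ≡-Reasoning

StrictlyDecreasingLyndon⇒All : ∀ {ls} → StrictlyDecreasingLyndon ls → All Lyndon ls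
StrictlyDecreasingLyndon⇒All []           = []
StrictlyDecreasingLyndon⇒All [ L ]        = L ∷ []
StrictlyDecreasingLyndon⇒All (_∷_ L _ ls) = L ∷ StrictlyDecreasingLyndon⇒All ls

proposition2p4 : (w : Word) → w ≢ [] →
    (ls : List Word) → StrictlyDecreasingLyndon ls → w ≡ concat ls →
    (k : ℕ) → HasComponents (LyndonGraph w) k → k ≤ length ls
proposition2p4 _ _ ls decreasing refl k components =
  HasComponents⇒≤ components (factor ls) (same-factor⇒connected (StrictlyDecreasingLyndon⇒All decreasing))
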